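{- For all integers $n>k\ge0$, $\displaystyle R_{2n}=R_{n-k}R_{n+k}+\sum_{i=1}^{n-k}\sum_{j=1}^{n+k}R_{n-k-i}R_{n+k-j}\widetilde R_{i+j}$.
   Context: Let $q\ge 4$ be an integer and consider the regular square mosaic $\{4,q\}$ (Schläfli symbol), i.e. the tiling of the Euclidean plane ($q=4$) or of the hyperbolic plane ($q\ge5$) by congruent regular squares with $q$ squares around each vertex. For $n\ge1$ the $(2\times n)$-board is defined as follows. Choose a square $S_1$ of the mosaic with vertices $A_0,A_1,B_1,B_0$ in cyclic order. Inductively, for $i\ge1$ let $S_{i+1}$ be the other square of the mosaic containing the edge $A_iB_i$, with vertices $A_i,A_{i+1},B_{i+1},B_i$ in cyclic order. The first level of the board consists of $S_1,\dots,S_n$; the second level consists of all squares of the mosaic having at least one vertex in $\{A_1,\dots,A_n\}$ and no vertex in $\{B_1,\dots,B_n,A_{n+1}\}$ (here $A_{n+1}$ is the vertex of $S_{n+1}$). The board is the union of both levels. For $1\le j\le n$ the $j$-th column consists of $S_j$ together with the second-level squares that contain $A_j$ but not $A_{j+1}$. A domino is a pair of squares of the board sharing an edge. Given positive integers $a,b$, a colored tiling is a partition of the squares of the board into single squares and dominoes, each single square receiving one of $a$ colors and each domino one of $b$ colors. A tiling is breakable in position $i$ ($1\le i\le n-1$) if no domino contains a square of the first $i$ columns and a square of the remaining columns; it is unbreakable if it is breakable in no position. $R_n$ is the number of colored tilings of the $(2\times n)$-board ($R_0=1$) and $\widetilde R_n$ the number of unbreakable colored tilings of it. -}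

module Defs where

open import Data.Nat using (ℕ; zero; suc; _+_; _*_; _∸_; _^_; _≡ᵇ_; _<ᵇ_; _≤ᵇ_)
open import Data.Bool using (Bool; true; false; _∧_; _∨_; not)
open import Data.List using (List; []; _∷_; map; upTo; length; filterᵇ; concatMap; _++_)
open import Data.Nat.ListAction using (sum)
open import Data.Bool.ListAction using (all; any)
open import Data.Product using (_×_; _,_; proj₁; proj₂)

-- Combinatorial model of the (2 × n)-board in the mosaic {4,q}.
-- A square is a pair (j , k): j ∈ {1..n} is its column, k = 0 is the
-- first-level square S_j, and k ∈ {1..q-3} is the k-th second-level square
-- of the fan around A_j (counted from the one adjacent to S_j).
Cell : Set
Cell = ℕ × ℕ

column : Cell → ℕ
column = proj₁

-- A domino = an (unordered) pair of board squares sharing an edge.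
Domino : Set
Domino = Cell × Cell

range1 : ℕ → List ℕ
range1 N = map suc (upTo N)

Σ₁ : ℕ → (ℕ → ℕ) → ℕ
Σ₁ N f = sum (map f (range1 N))

numSquares : ℕ → ℕ → ℕ
numSquares q n = n * (q ∸ 2)

boardDominoes : ℕ → ℕ → List Domino
boardDominoes q n = concatMap inner (range1 n) ++ concatMap cross (range1 (n ∸ 1))
  where
    m : ℕ
    m = q ∸ 2
    -- inside column j: S_j – U_{j,1} – U_{j,2} – … – U_{j,q-3}
    inner : ℕ → List Domino
    inner j = map (λ k → ((j , k) , (j , suc k))) (upTo (m ∸ 1))
    -- between columns j and j+1: S_j – S_{j+1}, and U_{j,q-3} – U_{j+1,1}
    cross : ℕ → List Domino
    cross j = ((j , 0) , (suc j , 0)) ∷ ((j , m ∸ 1) , (suc j , 1)) ∷ []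

sameCell : Cell → Cell → Bool
sameCell (j , k) (j' , k') = (j ≡ᵇ j') ∧ (k ≡ᵇ k')

overlaps : Domino → Domino → Bool
overlaps (c , d) (c' , d') = sameCell c c' ∨ sameCell c d' ∨ sameCell d c' ∨ sameCell d d'

pairwiseDisjoint : List Domino → Bool
pairwiseDisjoint [] = true
pairwiseDisjoint (e ∷ es) = all (λ f → not (overlaps e f)) es ∧ pairwiseDisjoint es

sublists : {A : Set} → List A → List (List A)
sublists [] = [] ∷ []
sublists (x ∷ xs) = sublists xs ++ map (x ∷_) (sublists xs)

-- Tilings of the (2 × n)-board, each given by its set of dominoes
-- (all remaining squares are single squares).
tilings : ℕ → ℕ → List (List Domino)
tilings q n = filterᵇ pairwiseDisjoint (sublists (boardDominoes q n))

-- number of colorings of a tiling: a colors per single square, b per domino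
colorings : ℕ → ℕ → ℕ → ℕ → List Domino → ℕ
colorings q a b n M = b ^ length M * a ^ (numSquares q n ∸ 2 * length M)

crosses : ℕ → Domino → Bool
crosses i (c , d) = ((column c ≤ᵇ i) ∧ (i <ᵇ column d)) ∨ ((column d ≤ᵇ i) ∧ (i <ᵇ column c))

breakableAt : ℕ → List Domino → Bool
breakableAt i M = not (any (crosses i) M)

unbreakable : ℕ → List Domino → Bool
unbreakable n M = all (λ i → not (breakableAt i M)) (range1 (n ∸ 1))

R : ℕ → ℕ → ℕ → ℕ → ℕ
R q a b n = sum (map (colorings q a b n) (tilings q n))

R̃ : ℕ → ℕ → ℕ → ℕ → ℕ
R̃ q a b n = sum (map (colorings q a b n) (filterᵇ (unbreakable n) (tilings q n)))

-- Classifying the tilings of the N-board by their first break L gives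
-- R N = Σ_{L=1}^{N} R̃ L · R (N − L) for N ≥ 1: a tiling breakable at L but at no
-- earlier position is an unbreakable tiling of the first L columns beside an
-- arbitrary tiling of the remaining N − L columns, using neither of the two
-- dominoes that join columns L and L + 1; the colourings multiply because the
-- squares and the dominoes of the two parts add up.
-- Any r with r 0 = 1 and r N = Σ_{L=1}^{N} u L · r (N − L) for N ≥ 1 satisfies
-- r (s + t) = r s · r t + Σ_{i,j ≥ 1} r (s − i) · r (t − j) · u (i + j): expand
-- r (s + t) by its first block, use the identity for the shorter s − L (strong
-- induction on s) and reorder the resulting double convolution.
module Submission where

open import Defs
import Algebra.Properties.CommutativeSemigroup as CommSemigroupProperties
import Algebra.Solver.CommutativeMonoid as CommutativeMonoidSolver
open import Data.Bool using (Bool; true; false; _∧_; _∨_; not; if_then_else_)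
open import Data.Bool.Properties
  using (∧-assoc; ∨-assoc; ∧-identityʳ; ∨-identityʳ; ∧-zeroʳ; ∨-zeroʳ; ∧-conicalˡ; ∧-conicalʳ; ∧-commutativeMonoid; ∨-commutativeMonoid)
open import Data.Bool.ListAction using (and; all; any)
open import Data.List using (List; []; _∷_; _++_; [_]; map; upTo; length; filter; filterᵇ; concatMap; cartesianProduct)
open import Data.List.Properties
  using (map-++; map-∘; map-cong; map-cong-local; ++-identityʳ; ++-assoc; upTo-∷ʳ; length-++; length-map; length-upTo;
         concatMap-++; concatMap-map; concatMap-cong; map-concatMap; filter-notAll)
open import Data.List.Membership.Propositional using (_∈_)
open import Data.List.Membership.Propositional.Properties using (∈-filter⁺; ∈-cartesianProduct⁺; ∈-map⁺; ∈-upTo⁺)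
open import Data.List.Relation.Binary.Subset.Propositional using (_⊆_)
open import Data.List.Relation.Unary.All as All using (All; []; _∷_)
open import Data.List.Relation.Unary.All.Properties using (map⁺; ++⁺; concat⁺; applyUpTo⁺₁)
open import Data.List.Relation.Unary.Any as Any using (here; there)
open import Data.List.Relation.Unary.Unique.Propositional using (Unique; []; _∷_)
open import Data.Nat using (ℕ; zero; suc; _+_; _*_; _∸_; _^_; _≤_; _<_; _≤?_; _<?_; _≡ᵇ_; _≤ᵇ_; _<ᵇ_; z≤n; s≤s)
open import Data.Nat.Induction using (<-rec)
open import Data.Nat.ListAction using (sum)
open import Data.Nat.ListAction.Properties using (sum-++)
open import Data.Nat.Properties
open import Data.Product using (_×_; _,_; proj₁; proj₂)
open import Data.Product.Properties using (≡-dec)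
open import Function using (_∘_)
open import Function.Bundles using (_⇔_; mk⇔)
open import Relation.Binary.Definitions using (DecidableEquality)
open import Relation.Binary.PropositionalEquality using (_≡_; _≢_; refl; sym; trans; cong; cong₂; module ≡-Reasoning)
open import Relation.Nullary using (does; ¬?)
open import Relation.Nullary.Decidable using (dec-true; dec-false; does-⇔)

open CommSemigroupProperties +-commutativeSemigroup using () renaming (interchange to +-interchange)
open CommSemigroupProperties *-commutativeSemigroup using () renaming (interchange to *-interchange; x∙yz≈y∙xz to *-left-comm)
module ∧-Solver = CommutativeMonoidSolver ∧-commutativeMonoid
module ∨-Solver = CommutativeMonoidSolver ∨-commutativeMonoid

-- Finite sums

∑ : {A : Set} → (A → ℕ) → List A → ℕ
∑ f xs = sum (map f xs)

module _ {A : Set} where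

  ∑-++ : ∀ (f : A → ℕ) xs ys → ∑ f (xs ++ ys) ≡ ∑ f xs + ∑ f ys
  ∑-++ f xs ys = trans (cong sum (map-++ f xs ys)) (sum-++ (map f xs) (map f ys))

  ∑-cong : ∀ {f g : A → ℕ} → (∀ x → f x ≡ g x) → ∀ xs → ∑ f xs ≡ ∑ g xs
  ∑-cong f≗g xs = cong sum (map-cong f≗g xs)

  ∑-congᴬ : ∀ {f g : A → ℕ} {xs} → All (λ x → f x ≡ g x) xs → ∑ f xs ≡ ∑ g xs
  ∑-congᴬ f≗g = cong sum (map-cong-local f≗g)

  ∑-zero : ∀ (xs : List A) → ∑ (λ _ → 0) xs ≡ 0
  ∑-zero []       = refl
  ∑-zero (_ ∷ xs) = ∑-zero xs

  ∑-+ : ∀ (f g : A → ℕ) xs → ∑ (λ x → f x + g x) xs ≡ ∑ f xs + ∑ g xs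
  ∑-+ f g []       = refl
  ∑-+ f g (x ∷ xs) = trans (cong (f x + g x +_) (∑-+ f g xs)) (+-interchange (f x) (g x) _ _)

  ∑-*ˡ : ∀ c (f : A → ℕ) xs → ∑ (λ x → c * f x) xs ≡ c * ∑ f xs
  ∑-*ˡ c f []       = sym (*-zeroʳ c)
  ∑-*ˡ c f (x ∷ xs) = trans (cong (c * f x +_) (∑-*ˡ c f xs)) (sym (*-distribˡ-+ c (f x) _))

  ∑-*ʳ : ∀ c (f : A → ℕ) xs → ∑ (λ x → f x * c) xs ≡ ∑ f xs * c
  ∑-*ʳ c f []       = refl
  ∑-*ʳ c f (x ∷ xs) = trans (cong (f x * c +_) (∑-*ʳ c f xs)) (sym (*-distribʳ-+ c (f x) _))

  ∑-filterᵇ : ∀ (p : A → Bool) (f : A → ℕ) xs → ∑ f (filterᵇ p xs) ≡ ∑ (λ x → if p x then f x else 0) xs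
  ∑-filterᵇ p f []       = refl
  ∑-filterᵇ p f (x ∷ xs) with p x
  ... | true  = cong (f x +_) (∑-filterᵇ p f xs)
  ... | false = ∑-filterᵇ p f xs

∑-map : ∀ {A B : Set} (f : B → ℕ) (g : A → B) xs → ∑ f (map g xs) ≡ ∑ (f ∘ g) xs
∑-map f g xs = cong sum (sym (map-∘ xs))

∑-comm : ∀ {A B : Set} (f : A → B → ℕ) xs ys → ∑ (λ x → ∑ (f x) ys) xs ≡ ∑ (λ y → ∑ (λ x → f x y) xs) ys
∑-comm f []       ys = sym (∑-zero ys)
∑-comm f (x ∷ xs) ys = trans (cong (∑ (f x) ys +_) (∑-comm f xs ys)) (sym (∑-+ (f x) _ ys))

∑-product : ∀ {A B : Set} (f : A → ℕ) (g : B → ℕ) xs ys → ∑ (λ x → ∑ (λ y → f x * g y) ys) xs ≡ ∑ f xs * ∑ g ys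
∑-product f g xs ys = trans (∑-cong (λ x → ∑-*ˡ (f x) g ys) xs) (∑-*ʳ (∑ g ys) f xs)

∑-product² : ∀ {A B C D : Set} (F : A → C → ℕ) (G : B → D → ℕ) as bs cs ds →
             ∑ (λ x → ∑ (λ y → ∑ (λ z → ∑ (λ w → F x z * G y w) ds) cs) bs) as
               ≡ ∑ (λ x → ∑ (F x) cs) as * ∑ (λ y → ∑ (G y) ds) bs
∑-product² F G as bs cs ds =
  trans (∑-cong (λ x → ∑-cong (λ y → ∑-product (F x) (G y) cs ds) bs) as)
        (∑-product (λ x → ∑ (F x) cs) (λ y → ∑ (G y) ds) as bs)

range1-suc : ∀ n → range1 (suc n) ≡ range1 n ++ [ suc n ]
range1-suc n = trans (cong (map suc) (sym (upTo-∷ʳ n))) (map-++ suc (upTo n) [ n ])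

range1-+ : ∀ s t → range1 (s + t) ≡ range1 s ++ map (s +_) (range1 t)
range1-+ s zero    = trans (cong range1 (+-identityʳ s)) (sym (++-identityʳ (range1 s)))
range1-+ s (suc t) = begin
  range1 (s + suc t)                                          ≡⟨ cong range1 (+-suc s t) ⟩
  range1 (suc (s + t))                                        ≡⟨ range1-suc (s + t) ⟩
  range1 (s + t) ++ [ suc (s + t) ]                           ≡⟨ cong₂ (λ xs x → xs ++ [ x ]) (range1-+ s t) (sym (+-suc s t)) ⟩
  (range1 s ++ map (s +_) (range1 t)) ++ [ s + suc t ]        ≡⟨ ++-assoc (range1 s) _ _ ⟩
  range1 s ++ (map (s +_) (range1 t) ++ map (s +_) [ suc t ]) ≡⟨ cong (range1 s ++_) (map-++ (s +_) (range1 t) _) ⟨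
  range1 s ++ map (s +_) (range1 t ++ [ suc t ])              ≡⟨ cong (λ xs → range1 s ++ map (s +_) xs) (range1-suc t) ⟨
  range1 s ++ map (s +_) (range1 (suc t))                     ∎
  where open ≡-Reasoning

range1-bounds : ∀ n → All (λ i → 1 ≤ i × i ≤ n) (range1 n)
range1-bounds n = map⁺ (applyUpTo⁺₁ (λ i → i) n (λ i<n → s≤s z≤n , i<n))

Σ₁-cong : ∀ N {f g : ℕ → ℕ} → (∀ i → 1 ≤ i → i ≤ N → f i ≡ g i) → Σ₁ N f ≡ Σ₁ N g
Σ₁-cong N f≗g = ∑-congᴬ (All.map (λ {i} (1≤i , i≤N) → f≗g i 1≤i i≤N) (range1-bounds N))

Σ₁-suc : ∀ N f → Σ₁ (suc N) f ≡ Σ₁ N f + f (suc N)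
Σ₁-suc N f = trans (cong (∑ f) (range1-suc N))
                   (trans (∑-++ f (range1 N) _) (cong (Σ₁ N f +_) (+-identityʳ (f (suc N)))))

Σ₁-+ : ∀ s t f → Σ₁ (s + t) f ≡ Σ₁ s f + Σ₁ t (λ j → f (s + j))
Σ₁-+ s t f = trans (cong (∑ f) (range1-+ s t))
                   (trans (∑-++ f (range1 s) _) (cong (Σ₁ s f +_) (∑-map f (s +_) (range1 t))))

Σ₁-truncate : ∀ {M} N h → M ≤ N → Σ₁ M h ≡ Σ₁ N (λ i → if does (i ≤? M) then h i else 0)
Σ₁-truncate {M} N h M≤N = begin
  Σ₁ M h
    ≡⟨ Σ₁-cong M (λ i _ i≤M → cong (λ b → if b then h i else 0) (sym (dec-true (i ≤? M) i≤M))) ⟩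
  Σ₁ M g
    ≡⟨ +-identityʳ _ ⟨
  Σ₁ M g + 0
    ≡⟨ cong (Σ₁ M g +_) beyond-M ⟨
  Σ₁ M g + Σ₁ (N ∸ M) (λ j → g (M + j))
    ≡⟨ Σ₁-+ M (N ∸ M) g ⟨
  Σ₁ (M + (N ∸ M)) g
    ≡⟨ cong (λ n → Σ₁ n g) (m+[n∸m]≡n M≤N) ⟩
  Σ₁ N g
    ∎
  where
  open ≡-Reasoning
  g : ℕ → ℕ
  g i = if does (i ≤? M) then h i else 0
  beyond-M : Σ₁ (N ∸ M) (λ j → g (M + j)) ≡ 0
  beyond-M = trans (Σ₁-cong (N ∸ M) λ { (suc j) _ _ →
                      cong (λ b → if b then h (M + suc j) else 0) (dec-false (M + suc j ≤? M) (m+1+n≰m M)) })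
                   (∑-zero (range1 (N ∸ M)))

m≤o∸n⇔m+n≤o : ∀ m n o → 1 ≤ m → m ≤ o ∸ n ⇔ m + n ≤ o
m≤o∸n⇔m+n≤o m n o 1≤m = mk⇔ (λ m≤o∸n → m≤o∸n⇒m+n≤o m (n≤o m≤o∸n) m≤o∸n) (m+n≤o⇒m≤o∸n m)
  where
  n≤o : m ≤ o ∸ n → n ≤ o
  n≤o m≤o∸n = <⇒≤ (m∸n≢0⇒n<m (<⇒≢ (≤-trans 1≤m m≤o∸n) ∘ sym))

Σ₁-triangle-swap : ∀ s (g : ℕ → ℕ → ℕ) → Σ₁ s (λ L → Σ₁ (s ∸ L) (g L)) ≡ Σ₁ s (λ i → Σ₁ (s ∸ i) (λ L → g L i))
Σ₁-triangle-swap s g = begin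
  Σ₁ s (λ L → Σ₁ (s ∸ L) (g L))
    ≡⟨ Σ₁-cong s (λ L _ _ → below L (g L)) ⟩
  Σ₁ s (λ L → Σ₁ s (λ i → if does (i + L ≤? s) then g L i else 0))
    ≡⟨ ∑-comm _ (range1 s) (range1 s) ⟩
  Σ₁ s (λ i → Σ₁ s (λ L → if does (i + L ≤? s) then g L i else 0))
    ≡⟨ Σ₁-cong s (λ i _ _ → Σ₁-cong s (λ L _ _ → cong (λ n → if does (n ≤? s) then g L i else 0) (+-comm i L))) ⟩
  Σ₁ s (λ i → Σ₁ s (λ L → if does (L + i ≤? s) then g L i else 0))
    ≡⟨ Σ₁-cong s (λ i _ _ → below i (λ L → g L i)) ⟨
  Σ₁ s (λ i → Σ₁ (s ∸ i) (λ L → g L i))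
    ∎
  where
  open ≡-Reasoning
  below : ∀ L h → Σ₁ (s ∸ L) h ≡ Σ₁ s (λ i → if does (i + L ≤? s) then h i else 0)
  below L h = trans (Σ₁-truncate s h (m∸n≤m s L))
                    (Σ₁-cong s (λ i 1≤i _ → cong (λ b → if b then h i else 0)
                                                 (does-⇔ (m≤o∸n⇔m+n≤o i L s 1≤i) (i ≤? s ∸ L) (i + L ≤? s))))

-- Convolution

_⋆_ : (ℕ → ℕ) → (ℕ → ℕ) → ℕ → ℕ
(f ⋆ g) n = Σ₁ n (λ i → f i * g (n ∸ i))

⋆-suc : ∀ f g n → (f ⋆ g) (suc n) ≡ Σ₁ n (λ i → f i * g (suc n ∸ i)) + f (suc n) * g 0
⋆-suc f g n = trans (Σ₁-suc n _) (cong (λ k → Σ₁ n (λ i → f i * g (suc n ∸ i)) + f (suc n) * g k) (n∸n≡0 n))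

⋆-left-comm : ∀ f g h n → (f ⋆ (g ⋆ h)) n ≡ (g ⋆ (f ⋆ h)) n
⋆-left-comm f g h n = begin
  Σ₁ n (λ L → f L * Σ₁ (n ∸ L) (λ i → g i * h (n ∸ L ∸ i)))
    ≡⟨ Σ₁-cong n (λ L _ _ → sym (∑-*ˡ (f L) _ (range1 (n ∸ L)))) ⟩
  Σ₁ n (λ L → Σ₁ (n ∸ L) (λ i → f L * (g i * h (n ∸ L ∸ i))))
    ≡⟨ Σ₁-triangle-swap n _ ⟩
  Σ₁ n (λ i → Σ₁ (n ∸ i) (λ L → f L * (g i * h (n ∸ L ∸ i))))
    ≡⟨ Σ₁-cong n (λ i _ _ → Σ₁-cong (n ∸ i) (λ L _ _ →
         trans (*-left-comm (f L) (g i) _) (cong (λ k → g i * (f L * h k)) (∸-swap L i)))) ⟩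
  Σ₁ n (λ i → Σ₁ (n ∸ i) (λ L → g i * (f L * h (n ∸ i ∸ L))))
    ≡⟨ Σ₁-cong n (λ i _ _ → ∑-*ˡ (g i) _ (range1 (n ∸ i))) ⟩
  Σ₁ n (λ i → g i * Σ₁ (n ∸ i) (λ L → f L * h (n ∸ i ∸ L)))
    ∎
  where
  open ≡-Reasoning
  ∸-swap : ∀ L i → n ∸ L ∸ i ≡ n ∸ i ∸ L
  ∸-swap L i = trans (∸-+-assoc n L i) (trans (cong (n ∸_) (+-comm L i)) (sym (∸-+-assoc n i L)))

module ConvolutionSplit (r u : ℕ → ℕ) (r-zero : r 0 ≡ 1)
                        (r-suc : ∀ n → r (suc n) ≡ (u ⋆ r) (suc n)) where

  -- V t i: a block straddling the split with i ≥ 1 columns to its left and j ≥ 1 to its right,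
  -- followed by any tiling of the other t − j columns on the right.
  V : ℕ → ℕ → ℕ
  V t i = Σ₁ t (λ j → r (t ∸ j) * u (i + j))

  ⋆-unfold : ∀ f n → (f ⋆ r) (suc n) ≡ (f ⋆ (u ⋆ r)) (suc n) + f (suc n)
  ⋆-unfold f n = begin
    (f ⋆ r) (suc n)
      ≡⟨ ⋆-suc f r n ⟩
    Σ₁ n (λ i → f i * r (suc n ∸ i)) + f (suc n) * r 0
      ≡⟨ cong₂ _+_ (Σ₁-cong n (λ i _ i≤n → cong (f i *_) (r-pos (m<n⇒0<n∸m (s≤s i≤n)))))
                   (trans (cong (f (suc n) *_) r-zero) (*-identityʳ (f (suc n)))) ⟩
    S + f (suc n)
      ≡⟨ cong (_+ f (suc n)) (trans (cong (S +_) (*-zeroʳ (f (suc n)))) (+-identityʳ S)) ⟨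
    S + f (suc n) * 0 + f (suc n)
      ≡⟨ cong (_+ f (suc n)) (⋆-suc f (u ⋆ r) n) ⟨
    (f ⋆ (u ⋆ r)) (suc n) + f (suc n)
      ∎
    where
    open ≡-Reasoning
    r-pos : ∀ {m} → 1 ≤ m → r m ≡ (u ⋆ r) m
    r-pos {suc m} _ = r-suc m
    S : ℕ
    S = Σ₁ n (λ i → f i * (u ⋆ r) (suc n ∸ i))

  r-+-⋆ : ∀ s t → r (s + t) ≡ r s * r t + (V t ⋆ r) s
  r-+-⋆ = <-rec _ step
    where
    step : ∀ s → (∀ {s′} → s′ < s → ∀ t → r (s′ + t) ≡ r s′ * r t + (V t ⋆ r) s′) →
           ∀ t → r (s + t) ≡ r s * r t + (V t ⋆ r) s
    step zero    _  t = sym (trans (+-identityʳ _) (trans (cong (_* r t) r-zero) (*-identityˡ (r t))))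
    step (suc s) ih t = begin
      r (suc s + t)
        ≡⟨ r-suc (s + t) ⟩
      Σ₁ (suc s + t) (λ L → u L * r (suc s + t ∸ L))
        ≡⟨ Σ₁-+ (suc s) t _ ⟩
      Σ₁ (suc s) (λ L → u L * r (suc s + t ∸ L)) + Σ₁ t (λ j → u (suc s + j) * r (suc s + t ∸ (suc s + j)))
        ≡⟨ cong₂ _+_ first-blocks last-block ⟩
      ((u ⋆ r) (suc s) * r t + (u ⋆ (V t ⋆ r)) (suc s)) + V t (suc s)
        ≡⟨ cong₂ (λ x y → (x * r t + y) + V t (suc s)) (sym (r-suc s)) (⋆-left-comm u (V t) r (suc s)) ⟩
      (r (suc s) * r t + (V t ⋆ (u ⋆ r)) (suc s)) + V t (suc s)
        ≡⟨ +-assoc (r (suc s) * r t) _ _ ⟩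
      r (suc s) * r t + ((V t ⋆ (u ⋆ r)) (suc s) + V t (suc s))
        ≡⟨ cong (r (suc s) * r t +_) (⋆-unfold (V t) s) ⟨
      r (suc s) * r t + (V t ⋆ r) (suc s)
        ∎
      where
      open ≡-Reasoning
      shorter : ∀ {L} → 1 ≤ L → L ≤ suc s → suc s ∸ L < suc s
      shorter {suc L} _ _ = s≤s (m∸n≤m s L)
      first-blocks : Σ₁ (suc s) (λ L → u L * r (suc s + t ∸ L)) ≡ (u ⋆ r) (suc s) * r t + (u ⋆ (V t ⋆ r)) (suc s)
      first-blocks = begin
        Σ₁ (suc s) (λ L → u L * r (suc s + t ∸ L))
          ≡⟨ Σ₁-cong (suc s) (λ L 1≤L L≤s → cong (u L *_) (trans (cong r (+-∸-comm t L≤s)) (ih (shorter 1≤L L≤s) t))) ⟩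
        Σ₁ (suc s) (λ L → u L * (r (suc s ∸ L) * r t + (V t ⋆ r) (suc s ∸ L)))
          ≡⟨ Σ₁-cong (suc s) (λ L _ _ → trans (*-distribˡ-+ (u L) _ _)
                                              (cong (_+ u L * (V t ⋆ r) (suc s ∸ L)) (sym (*-assoc (u L) (r (suc s ∸ L)) (r t))))) ⟩
        Σ₁ (suc s) (λ L → u L * r (suc s ∸ L) * r t + u L * (V t ⋆ r) (suc s ∸ L))
          ≡⟨ ∑-+ (λ L → u L * r (suc s ∸ L) * r t) (λ L → u L * (V t ⋆ r) (suc s ∸ L)) (range1 (suc s)) ⟩
        Σ₁ (suc s) (λ L → u L * r (suc s ∸ L) * r t) + (u ⋆ (V t ⋆ r)) (suc s)
          ≡⟨ cong (_+ (u ⋆ (V t ⋆ r)) (suc s)) (∑-*ʳ (r t) (λ L → u L * r (suc s ∸ L)) (range1 (suc s))) ⟩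
        (u ⋆ r) (suc s) * r t + (u ⋆ (V t ⋆ r)) (suc s)
          ∎
      last-block : Σ₁ t (λ j → u (suc s + j) * r (suc s + t ∸ (suc s + j))) ≡ V t (suc s)
      last-block = Σ₁-cong t (λ j _ _ → trans (cong (λ x → u (suc s + j) * r x) ([m+n]∸[m+o]≡n∸o (suc s) t j))
                                               (*-comm (u (suc s + j)) _))

  r-+ : ∀ s t → r (s + t) ≡ r s * r t + Σ₁ s (λ i → Σ₁ t (λ j → r (s ∸ i) * r (t ∸ j) * u (i + j)))
  r-+ s t = trans (r-+-⋆ s t) (cong (r s * r t +_) (Σ₁-cong s (λ i _ _ →
              trans (*-comm (V t i) (r (s ∸ i)))
                    (trans (sym (∑-*ˡ (r (s ∸ i)) _ (range1 t)))
                           (Σ₁-cong t (λ j _ _ → sym (*-assoc (r (s ∸ i)) _ _)))))))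

module _ {A : Set} where

  ∑-sublists-++ : ∀ (f : List A → ℕ) xs ys →
                  ∑ f (sublists (xs ++ ys)) ≡ ∑ (λ P → ∑ (λ Q → f (P ++ Q)) (sublists ys)) (sublists xs)
  ∑-sublists-++ f []       ys = sym (+-identityʳ _)
  ∑-sublists-++ f (x ∷ xs) ys = begin
    ∑ f (sublists (xs ++ ys) ++ map (x ∷_) (sublists (xs ++ ys)))
      ≡⟨ ∑-++ f (sublists (xs ++ ys)) _ ⟩
    ∑ f (sublists (xs ++ ys)) + ∑ f (map (x ∷_) (sublists (xs ++ ys)))
      ≡⟨ cong₂ _+_ (∑-sublists-++ f xs ys)
                   (trans (∑-map f (x ∷_) (sublists (xs ++ ys))) (∑-sublists-++ (f ∘ (x ∷_)) xs ys)) ⟩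
    ∑ g (sublists xs) + ∑ (g ∘ (x ∷_)) (sublists xs)
      ≡⟨ cong (∑ g (sublists xs) +_) (∑-map g (x ∷_) (sublists xs)) ⟨
    ∑ g (sublists xs) + ∑ g (map (x ∷_) (sublists xs))
      ≡⟨ ∑-++ g (sublists xs) _ ⟨
    ∑ g (sublists (x ∷ xs))
      ∎
    where
    open ≡-Reasoning
    g : List A → ℕ
    g P = ∑ (λ Q → f (P ++ Q)) (sublists ys)

  ∑-sublists-congᴬ : ∀ {P : A → Set} {xs} → All P xs → {f g : List A → ℕ} →
                     (∀ M → All P M → f M ≡ g M) → ∑ f (sublists xs) ≡ ∑ g (sublists xs)
  ∑-sublists-congᴬ []                f≗g = cong (_+ 0) (f≗g [] [])
  ∑-sublists-congᴬ {xs = x ∷ xs} (px ∷ pxs) {f} {g} f≗g = begin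
    ∑ f (sublists (x ∷ xs))
      ≡⟨ ∑-++ f (sublists xs) _ ⟩
    ∑ f (sublists xs) + ∑ f (map (x ∷_) (sublists xs))
      ≡⟨ cong₂ _+_ (∑-sublists-congᴬ pxs f≗g) (∑-map f (x ∷_) (sublists xs)) ⟩
    ∑ g (sublists xs) + ∑ (f ∘ (x ∷_)) (sublists xs)
      ≡⟨ cong (∑ g (sublists xs) +_) (∑-sublists-congᴬ pxs (λ M pM → f≗g (x ∷ M) (px ∷ pM))) ⟩
    ∑ g (sublists xs) + ∑ (g ∘ (x ∷_)) (sublists xs)
      ≡⟨ cong (∑ g (sublists xs) +_) (∑-map g (x ∷_) (sublists xs)) ⟨
    ∑ g (sublists xs) + ∑ g (map (x ∷_) (sublists xs))
      ≡⟨ ∑-++ g (sublists xs) _ ⟨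
    ∑ g (sublists (x ∷ xs))
      ∎
    where open ≡-Reasoning

  ∑-sublists-[] : ∀ {P : A → Set} {xs} → All P xs → {f : List A → ℕ} →
                  (∀ {x} M → P x → f (x ∷ M) ≡ 0) → ∑ f (sublists xs) ≡ f []
  ∑-sublists-[] []                _      = +-identityʳ _
  ∑-sublists-[] {xs = x ∷ xs} (px ∷ pxs) {f} f-vanishes = begin
    ∑ f (sublists (x ∷ xs))
      ≡⟨ ∑-++ f (sublists xs) _ ⟩
    ∑ f (sublists xs) + ∑ f (map (x ∷_) (sublists xs))
      ≡⟨ cong₂ _+_ (∑-sublists-[] pxs f-vanishes) (∑-map f (x ∷_) (sublists xs)) ⟩
    f [] + ∑ (f ∘ (x ∷_)) (sublists xs)
      ≡⟨ cong (f [] +_) (trans (∑-cong (λ M → f-vanishes M px) (sublists xs)) (∑-zero (sublists xs))) ⟩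
    f [] + 0
      ≡⟨ +-identityʳ (f []) ⟩
    f []
      ∎
    where open ≡-Reasoning

sublists-map : ∀ {A B : Set} (g : A → B) xs → sublists (map g xs) ≡ map (map g) (sublists xs)
sublists-map g []       = refl
sublists-map g (x ∷ xs) = begin
  sublists (map g xs) ++ map (g x ∷_) (sublists (map g xs))
    ≡⟨ cong (λ S → S ++ map (g x ∷_) S) (sublists-map g xs) ⟩
  map (map g) (sublists xs) ++ map (g x ∷_) (map (map g) (sublists xs))
    ≡⟨ cong (map (map g) (sublists xs) ++_) (trans (sym (map-∘ (sublists xs))) (map-∘ (sublists xs))) ⟩
  map (map g) (sublists xs) ++ map (map g) (map (x ∷_) (sublists xs))
    ≡⟨ map-++ (map g) (sublists xs) _ ⟨
  map (map g) (sublists (x ∷ xs))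
    ∎
  where open ≡-Reasoning

∑-sublists-++-map : ∀ {A B : Set} (f : List B → ℕ) xs (g : A → B) ys →
                    ∑ f (sublists (xs ++ map g ys)) ≡ ∑ (λ P → ∑ (λ Q → f (P ++ map g Q)) (sublists ys)) (sublists xs)
∑-sublists-++-map f xs g ys =
  trans (∑-sublists-++ f xs (map g ys))
        (∑-cong (λ P → trans (cong (∑ (λ Q → f (P ++ Q))) (sublists-map g ys)) (∑-map _ (map g) (sublists ys))) (sublists xs))

module _ {A : Set} (p : A → Bool) where

  all-++ : ∀ xs ys → all p (xs ++ ys) ≡ all p xs ∧ all p ys
  all-++ []       ys = refl
  all-++ (x ∷ xs) ys = trans (cong (p x ∧_) (all-++ xs ys)) (sym (∧-assoc (p x) _ _))

  any-++ : ∀ xs ys → any p (xs ++ ys) ≡ any p xs ∨ any p ys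
  any-++ []       ys = refl
  any-++ (x ∷ xs) ys = trans (cong (p x ∨_) (any-++ xs ys)) (sym (∨-assoc (p x) _ _))

  all-true : ∀ {xs} → All (λ x → p x ≡ true) xs → all p xs ≡ true
  all-true []          = refl
  all-true (px ∷ pxs) = cong₂ _∧_ px (all-true pxs)

  any-false : ∀ {xs} → All (λ x → p x ≡ false) xs → any p xs ≡ false
  any-false []          = refl
  any-false (px ∷ pxs) = cong₂ _∨_ px (any-false pxs)

  any-++ʳ : ∀ xs {ys} → any p ys ≡ true → any p (xs ++ ys) ≡ true
  any-++ʳ xs {ys} h = trans (any-++ xs ys) (trans (cong (any p xs ∨_) h) (∨-zeroʳ (any p xs)))

all-congᴬ : ∀ {A : Set} {p p′ : A → Bool} {xs} → All (λ x → p x ≡ p′ x) xs → all p xs ≡ all p′ xs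
all-congᴬ eqs = cong and (map-cong-local eqs)

any-interleave : ∀ {A : Set} (p : A → Bool) A₁ A₂ C₁ C₂ →
                 any p ((A₁ ++ A₂) ++ (C₁ ++ C₂)) ≡ any p (A₁ ++ C₁) ∨ any p (A₂ ++ C₂)
any-interleave p A₁ A₂ C₁ C₂
  rewrite any-++ p (A₁ ++ A₂) (C₁ ++ C₂) | any-++ p A₁ A₂ | any-++ p C₁ C₂ | any-++ p A₁ C₁ | any-++ p A₂ C₂ =
    solve 4 (λ a₁ a₂ c₁ c₂ → (a₁ ⊕ a₂) ⊕ (c₁ ⊕ c₂) ⊜ (a₁ ⊕ c₁) ⊕ (a₂ ⊕ c₂)) refl
      (any p A₁) (any p A₂) (any p C₁) (any p C₂)
  where open ∨-Solver

length-interleave : ∀ {A : Set} (A₁ A₂ C₁ C₂ : List A) →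
                    length ((A₁ ++ A₂) ++ (C₁ ++ C₂)) ≡ length (A₁ ++ C₁) + length (A₂ ++ C₂)
length-interleave A₁ A₂ C₁ C₂
  rewrite length-++ (A₁ ++ A₂) {C₁ ++ C₂} | length-++ A₁ {A₂} | length-++ C₁ {C₂} | length-++ A₁ {C₁} | length-++ A₂ {C₂} =
    +-interchange (length A₁) (length A₂) (length C₁) (length C₂)

module _ {A : Set} (_≟_ : DecidableEquality A) where

  Unique-⊆⇒length≤ : ∀ {xs ys : List A} → Unique xs → xs ⊆ ys → length xs ≤ length ys
  Unique-⊆⇒length≤ {[]}             _              _     = z≤n
  Unique-⊆⇒length≤ {x ∷ xs} {ys} (x∉xs ∷ xs!) xs⊆ys =
    ≤-trans (s≤s (Unique-⊆⇒length≤ xs! xs⊆others))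
            (filter-notAll (¬? ∘ (x ≟_)) ys (Any.map (λ x≡y x≢y → x≢y x≡y) (xs⊆ys (here refl))))
    where
    xs⊆others : xs ⊆ filter (¬? ∘ (x ≟_)) ys
    xs⊆others y∈xs = ∈-filter⁺ (¬? ∘ (x ≟_)) (xs⊆ys (there y∈xs)) (All.lookup x∉xs y∈xs)

length-cartesianProduct : ∀ {A B : Set} (xs : List A) (ys : List B) →
                          length (cartesianProduct xs ys) ≡ length xs * length ys
length-cartesianProduct []       ys = refl
length-cartesianProduct (x ∷ xs) ys =
  trans (length-++ (map (x ,_) ys)) (cong₂ _+_ (length-map (x ,_) ys) (length-cartesianProduct xs ys))

≤∸1⇒< : ∀ {i n} → 1 ≤ i → i ≤ n ∸ 1 → i < n
≤∸1⇒< {suc i} {suc n} _ i≤n = s≤s i≤n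

∸-+-interchange : ∀ {u P v Q} → u ≤ P → v ≤ Q → (P + Q) ∸ (u + v) ≡ (P ∸ u) + (Q ∸ v)
∸-+-interchange {P = P} z≤n       v≤Q = +-∸-assoc P v≤Q
∸-+-interchange         (s≤s u≤P) v≤Q = ∸-+-interchange u≤P v≤Q

-- Dominoes

≤ᵇ-true : ∀ {m n} → m ≤ n → (m ≤ᵇ n) ≡ true
≤ᵇ-true {m} {n} = dec-true (m ≤? n)

≤ᵇ-false : ∀ {m n} → n < m → (m ≤ᵇ n) ≡ false
≤ᵇ-false {m} {n} n<m = dec-false (m ≤? n) (<⇒≱ n<m)

<ᵇ-true : ∀ {m n} → m < n → (m <ᵇ n) ≡ true
<ᵇ-true {m} {n} = dec-true (m <? n)

<ᵇ-false : ∀ {m n} → n ≤ m → (m <ᵇ n) ≡ false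
<ᵇ-false {m} {n} n≤m = dec-false (m <? n) (≤⇒≯ n≤m)

≡ᵇ-false : ∀ {m n} → m ≢ n → (m ≡ᵇ n) ≡ false
≡ᵇ-false {m} {n} = dec-false (m ≟ n)

sameCell-refl : ∀ c → sameCell c c ≡ true
sameCell-refl (j , k) = cong₂ _∧_ (dec-true (j ≟ j) refl) (dec-true (k ≟ k) refl)

sameCell-false⇒≢ : ∀ {c d} → sameCell c d ≡ false → c ≢ d
sameCell-false⇒≢ {c} c≁c refl with () ← trans (sym (sameCell-refl c)) c≁c

shift : ℕ → Domino → Domino
shift L ((j , k) , (j′ , k′)) = ((L + j , k) , (L + j′ , k′))

LeftOf RightOf : ℕ → Domino → Set
LeftOf L ((j , _) , (j′ , _)) = j ≤ L × j′ ≤ L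
RightOf L ((j , _) , (j′ , _)) = L < j × L < j′

crosses-LeftOf : ∀ {i} d → LeftOf i d → crosses i d ≡ false
crosses-LeftOf {i} ((j , _) , (j′ , _)) (j≤i , j′≤i)
  rewrite <ᵇ-false j≤i | <ᵇ-false j′≤i | ∧-zeroʳ (j ≤ᵇ i) | ∧-zeroʳ (j′ ≤ᵇ i) = refl

crosses-RightOf : ∀ {i} d → RightOf i d → crosses i d ≡ false
crosses-RightOf ((j , _) , (j′ , _)) (i<j , i<j′) rewrite ≤ᵇ-false i<j | ≤ᵇ-false i<j′ = refl

crosses-step : ∀ L k k′ → crosses L ((L , k) , (suc L , k′)) ≡ true
crosses-step L k k′ rewrite ≤ᵇ-true (≤-refl {L}) | <ᵇ-true (n<1+n L) = refl

RightOf-mono : ∀ {i L} d → i ≤ L → RightOf L d → RightOf i d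
RightOf-mono ((j , _) , (j′ , _)) i≤L (L<j , L<j′) = ≤-<-trans i≤L L<j , ≤-<-trans i≤L L<j′

overlaps-LeftOf-RightOf : ∀ {L} e f → LeftOf L e → RightOf L f → overlaps e f ≡ false
overlaps-LeftOf-RightOf ((j₁ , _) , (j₂ , _)) ((i₁ , _) , (i₂ , _)) (j₁≤L , j₂≤L) (L<i₁ , L<i₂)
  rewrite ≡ᵇ-false (<⇒≢ (≤-<-trans j₁≤L L<i₁)) | ≡ᵇ-false (<⇒≢ (≤-<-trans j₁≤L L<i₂))
        | ≡ᵇ-false (<⇒≢ (≤-<-trans j₂≤L L<i₁)) | ≡ᵇ-false (<⇒≢ (≤-<-trans j₂≤L L<i₂)) = refl

overlaps-RightOf-LeftOf : ∀ {L} e f → RightOf L e → LeftOf L f → overlaps e f ≡ false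
overlaps-RightOf-LeftOf ((j₁ , _) , (j₂ , _)) ((i₁ , _) , (i₂ , _)) (L<j₁ , L<j₂) (i₁≤L , i₂≤L)
  rewrite ≡ᵇ-false (>⇒≢ (≤-<-trans i₁≤L L<j₁)) | ≡ᵇ-false (>⇒≢ (≤-<-trans i₂≤L L<j₁))
        | ≡ᵇ-false (>⇒≢ (≤-<-trans i₁≤L L<j₂)) | ≡ᵇ-false (>⇒≢ (≤-<-trans i₂≤L L<j₂)) = refl

avoids : Domino → List Domino → Bool
avoids e ys = all (λ f → not (overlaps e f)) ys

disjoint : List Domino → List Domino → Bool
disjoint xs ys = all (λ e → avoids e ys) xs

disjoint-++ʳ : ∀ xs ys zs → disjoint xs (ys ++ zs) ≡ disjoint xs ys ∧ disjoint xs zs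
disjoint-++ʳ []       ys zs = refl
disjoint-++ʳ (x ∷ xs) ys zs
  rewrite all-++ (λ f → not (overlaps x f)) ys zs | disjoint-++ʳ xs ys zs =
    solve 4 (λ a b c d → (a ⊕ b) ⊕ (c ⊕ d) ⊜ (a ⊕ c) ⊕ (b ⊕ d)) refl
      (avoids x ys) (avoids x zs) (disjoint xs ys) (disjoint xs zs)
  where open ∧-Solver

pairwiseDisjoint-++ : ∀ xs ys → pairwiseDisjoint (xs ++ ys) ≡ pairwiseDisjoint xs ∧ (pairwiseDisjoint ys ∧ disjoint xs ys)
pairwiseDisjoint-++ []       ys = sym (∧-identityʳ (pairwiseDisjoint ys))
pairwiseDisjoint-++ (x ∷ xs) ys
  rewrite all-++ (λ f → not (overlaps x f)) xs ys | pairwiseDisjoint-++ xs ys =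
    solve 5 (λ a b c d e → (a ⊕ b) ⊕ (c ⊕ (d ⊕ e)) ⊜ (a ⊕ c) ⊕ (d ⊕ (b ⊕ e))) refl
      (avoids x xs) (avoids x ys) (pairwiseDisjoint xs) (pairwiseDisjoint ys) (disjoint xs ys)
  where open ∧-Solver

pairwiseDisjoint-interleave : ∀ A₁ A₂ C₁ C₂ →
  pairwiseDisjoint ((A₁ ++ A₂) ++ (C₁ ++ C₂))
    ≡ (pairwiseDisjoint (A₁ ++ C₁) ∧ pairwiseDisjoint (A₂ ++ C₂))
      ∧ ((disjoint A₁ A₂ ∧ disjoint C₁ C₂) ∧ (disjoint A₁ C₂ ∧ disjoint A₂ C₁))
pairwiseDisjoint-interleave A₁ A₂ C₁ C₂
  rewrite pairwiseDisjoint-++ (A₁ ++ A₂) (C₁ ++ C₂)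
        | pairwiseDisjoint-++ A₁ A₂ | pairwiseDisjoint-++ C₁ C₂
        | pairwiseDisjoint-++ A₁ C₁ | pairwiseDisjoint-++ A₂ C₂
        | all-++ (λ e → avoids e (C₁ ++ C₂)) A₁ A₂
        | disjoint-++ʳ A₁ C₁ C₂ | disjoint-++ʳ A₂ C₁ C₂ =
    solve 10 (λ pA₁ pA₂ pC₁ pC₂ dA₁A₂ dC₁C₂ dA₁C₁ dA₁C₂ dA₂C₁ dA₂C₂ →
                (pA₁ ⊕ (pA₂ ⊕ dA₁A₂)) ⊕ ((pC₁ ⊕ (pC₂ ⊕ dC₁C₂)) ⊕ ((dA₁C₁ ⊕ dA₁C₂) ⊕ (dA₂C₁ ⊕ dA₂C₂)))
              ⊜ ((pA₁ ⊕ (pC₁ ⊕ dA₁C₁)) ⊕ (pA₂ ⊕ (pC₂ ⊕ dA₂C₂))) ⊕ ((dA₁A₂ ⊕ dC₁C₂) ⊕ (dA₁C₂ ⊕ dA₂C₁)))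
      refl
      (pairwiseDisjoint A₁) (pairwiseDisjoint A₂) (pairwiseDisjoint C₁) (pairwiseDisjoint C₂)
      (disjoint A₁ A₂) (disjoint C₁ C₂) (disjoint A₁ C₁) (disjoint A₁ C₂) (disjoint A₂ C₁) (disjoint A₂ C₂)
  where open ∧-Solver

disjoint-separated : ∀ {P Q : Domino → Set} → (∀ e f → P e → Q f → overlaps e f ≡ false) →
                     ∀ {xs ys} → All P xs → All Q ys → disjoint xs ys ≡ true
disjoint-separated apart pxs qys =
  all-true _ (All.map (λ {e} pe → all-true _ (All.map (λ {f} qf → cong not (apart e f pe qf)) qys)) pxs)

≡ᵇ-+ : ∀ L j i → (L + j ≡ᵇ L + i) ≡ (j ≡ᵇ i)
≡ᵇ-+ zero    j i = refl
≡ᵇ-+ (suc L) j i = ≡ᵇ-+ L j i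

overlaps-shift : ∀ L e f → overlaps (shift L e) (shift L f) ≡ overlaps e f
overlaps-shift L ((j₁ , _) , (j₂ , _)) ((i₁ , _) , (i₂ , _))
  rewrite ≡ᵇ-+ L j₁ i₁ | ≡ᵇ-+ L j₁ i₂ | ≡ᵇ-+ L j₂ i₁ | ≡ᵇ-+ L j₂ i₂ = refl

pairwiseDisjoint-shift : ∀ L xs → pairwiseDisjoint (map (shift L) xs) ≡ pairwiseDisjoint xs
pairwiseDisjoint-shift L []       = refl
pairwiseDisjoint-shift L (x ∷ xs) = cong₂ _∧_ avoids-shift (pairwiseDisjoint-shift L xs)
  where
  avoids-shift : avoids (shift L x) (map (shift L) xs) ≡ avoids x xs
  avoids-shift = trans (cong and (sym (map-∘ xs))) (cong and (map-cong (λ f → cong not (overlaps-shift L x f)) xs))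

cells : List Domino → List Cell
cells []              = []
cells ((c , d) ∷ M) = c ∷ d ∷ cells M

length-cells : ∀ M → length (cells M) ≡ 2 * length M
length-cells []              = refl
length-cells ((c , d) ∷ M) = cong suc (trans (cong suc (length-cells M)) (sym (+-suc (length M) (length M + 0))))

not-true : ∀ {x} → not x ≡ true → x ≡ false
not-true {false} _ = refl

no-overlap⇒≢ : ∀ c d c′ d′ → overlaps (c , d) (c′ , d′) ≡ false → c ≢ c′ × c ≢ d′ × d ≢ c′ × d ≢ d′
no-overlap⇒≢ c d c′ d′ h
  with sameCell c c′ in e₁ | sameCell c d′ in e₂ | sameCell d c′ in e₃ | sameCell d d′ in e₄
no-overlap⇒≢ c d c′ d′ () | true  | _     | _     | _
no-overlap⇒≢ c d c′ d′ () | false | true  | _     | _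
no-overlap⇒≢ c d c′ d′ () | false | false | true  | _
no-overlap⇒≢ c d c′ d′ () | false | false | false | true
no-overlap⇒≢ c d c′ d′ _  | false | false | false | false =
  sameCell-false⇒≢ e₁ , sameCell-false⇒≢ e₂ , sameCell-false⇒≢ e₃ , sameCell-false⇒≢ e₄

avoids⇒cells-≢ : ∀ c d M → avoids (c , d) M ≡ true → All (c ≢_) (cells M) × All (d ≢_) (cells M)
avoids⇒cells-≢ c d []                  _ = [] , []
avoids⇒cells-≢ c d ((c′ , d′) ∷ M) h
  with c≢c′ , c≢d′ , d≢c′ , d≢d′ ← no-overlap⇒≢ c d c′ d′ (not-true (∧-conicalˡ _ (avoids (c , d) M) h))
     | c≢ , d≢ ← avoids⇒cells-≢ c d M (∧-conicalʳ (not (overlaps (c , d) (c′ , d′))) _ h) =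
    (c≢c′ ∷ c≢d′ ∷ c≢) , (d≢c′ ∷ d≢d′ ∷ d≢)

pairwiseDisjoint⇒Unique-cells : ∀ M → All (λ (c , d) → c ≢ d) M → pairwiseDisjoint M ≡ true → Unique (cells M)
pairwiseDisjoint⇒Unique-cells []              _              _ = []
pairwiseDisjoint⇒Unique-cells ((c , d) ∷ M) (c≢d ∷ distinct) h
  with c≢ , d≢ ← avoids⇒cells-≢ c d M (∧-conicalˡ _ (pairwiseDisjoint M) h) =
    (c≢d ∷ c≢) ∷ d≢ ∷ pairwiseDisjoint⇒Unique-cells M distinct (∧-conicalʳ (avoids (c , d) M) _ h)

-- The board

module Board (q : ℕ) where

  m : ℕ
  m = q ∸ 2

  InBoard : ℕ → Cell → Set
  InBoard n (j , k) = 1 ≤ j × j ≤ n × k < m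

  Valid : ℕ → Domino → Set
  Valid n (c , d) = InBoard n c × InBoard n d × c ≢ d

  Valid⇒LeftOf : ∀ {n} d → Valid n d → LeftOf n d
  Valid⇒LeftOf ((j , _) , (j′ , _)) ((_ , j≤n , _) , (_ , j′≤n , _) , _) = j≤n , j′≤n

  Valid⇒RightOf-shift : ∀ {L K} d → Valid K d → RightOf L (shift L d)
  Valid⇒RightOf-shift {L} ((j , _) , (j′ , _)) ((1≤j , _) , (1≤j′ , _) , _) = m<m+n L 1≤j , m<m+n L 1≤j′

  boardCells : ℕ → List Cell
  boardCells n = cartesianProduct (range1 n) (upTo m)

  InBoard⇒∈ : ∀ {n} c → InBoard n c → c ∈ boardCells n
  InBoard⇒∈ (suc j , k) (_ , j<n , k<m) = ∈-cartesianProduct⁺ (∈-map⁺ suc (∈-upTo⁺ j<n)) (∈-upTo⁺ k<m)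

  Valid⇒InBoard-cells : ∀ {n} M → All (Valid n) M → All (InBoard n) (cells M)
  Valid⇒InBoard-cells []              []                          = []
  Valid⇒InBoard-cells ((c , d) ∷ M) ((c∈ , d∈ , _) ∷ valid) = c∈ ∷ d∈ ∷ Valid⇒InBoard-cells M valid

  tiling-bound : ∀ {n} M → All (Valid n) M → pairwiseDisjoint M ≡ true → 2 * length M ≤ numSquares q n
  tiling-bound {n} M valid disjoint = begin
    2 * length M
      ≡⟨ length-cells M ⟨
    length (cells M)
      ≤⟨ Unique-⊆⇒length≤ (≡-dec _≟_ _≟_) unique cells⊆board ⟩
    length (boardCells n)
      ≡⟨ length-cartesianProduct (range1 n) (upTo m) ⟩
    length (range1 n) * length (upTo m)
      ≡⟨ cong₂ _*_ (trans (length-map suc (upTo n)) (length-upTo n)) (length-upTo m) ⟩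
    n * m
      ∎
    where
    open ≤-Reasoning
    unique : Unique (cells M)
    unique = pairwiseDisjoint⇒Unique-cells M (All.map proj₂ (All.map proj₂ valid)) disjoint
    cells⊆board : cells M ⊆ boardCells n
    cells⊆board c∈ = InBoard⇒∈ _ (All.lookup (Valid⇒InBoard-cells M valid) c∈)

  innerDominoes : ℕ → List Domino
  innerDominoes j = map (λ k → ((j , k) , (j , suc k))) (upTo (m ∸ 1))

  crossDominoes : ℕ → List Domino
  crossDominoes j = ((j , 0) , (suc j , 0)) ∷ ((j , m ∸ 1) , (suc j , 1)) ∷ []

  inner cross : ℕ → List Domino
  inner n = concatMap innerDominoes (range1 n)
  cross n = concatMap crossDominoes (range1 (n ∸ 1))

  boardDominoes-inner-cross : ∀ n → boardDominoes q n ≡ inner n ++ cross n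
  boardDominoes-inner-cross n = refl

  concatMap-shift : ∀ L {f : ℕ → List Domino} → (∀ j → f (L + j) ≡ map (shift L) (f j)) →
                    ∀ js → concatMap f (map (L +_) js) ≡ map (shift L) (concatMap f js)
  concatMap-shift L {f} f-shift js = begin
    concatMap f (map (L +_) js)             ≡⟨ concatMap-map f (L +_) js ⟩
    concatMap (f ∘ (L +_)) js               ≡⟨ concatMap-cong f-shift js ⟩
    concatMap (map (shift L) ∘ f) js        ≡⟨ map-concatMap (shift L) f js ⟨
    map (shift L) (concatMap f js)          ∎
    where open ≡-Reasoning

  inner-+ : ∀ L K → inner (L + K) ≡ inner L ++ map (shift L) (inner K)
  inner-+ L K = begin
    concatMap innerDominoes (range1 (L + K))
      ≡⟨ cong (concatMap innerDominoes) (range1-+ L K) ⟩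
    concatMap innerDominoes (range1 L ++ map (L +_) (range1 K))
      ≡⟨ concatMap-++ innerDominoes (range1 L) _ ⟩
    inner L ++ concatMap innerDominoes (map (L +_) (range1 K))
      ≡⟨ cong (inner L ++_) (concatMap-shift L (λ j → map-∘ (upTo (m ∸ 1))) (range1 K)) ⟩
    inner L ++ map (shift L) (inner K)
      ∎
    where open ≡-Reasoning

  cross-+ : ∀ L K → cross (suc L + suc K) ≡ cross (suc L) ++ (crossDominoes (suc L) ++ map (shift (suc L)) (cross (suc K)))
  cross-+ L K = begin
    concatMap crossDominoes (range1 (L + suc K))
      ≡⟨ cong (concatMap crossDominoes) (trans (cong range1 (+-suc L K)) (range1-+ (suc L) K)) ⟩
    concatMap crossDominoes (range1 (suc L) ++ map (suc L +_) (range1 K))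
      ≡⟨ concatMap-++ crossDominoes (range1 (suc L)) _ ⟩
    concatMap crossDominoes (range1 (suc L)) ++ concatMap crossDominoes (map (suc L +_) (range1 K))
      ≡⟨ cong₂ _++_ last-column (concatMap-shift (suc L) crossDominoes-shift (range1 K)) ⟩
    (cross (suc L) ++ crossDominoes (suc L)) ++ map (shift (suc L)) (cross (suc K))
      ≡⟨ ++-assoc (cross (suc L)) _ _ ⟩
    cross (suc L) ++ (crossDominoes (suc L) ++ map (shift (suc L)) (cross (suc K)))
      ∎
    where
    open ≡-Reasoning
    crossDominoes-shift : ∀ j → crossDominoes (suc L + j) ≡ map (shift (suc L)) (crossDominoes j)
    crossDominoes-shift j rewrite +-suc (suc L) j = refl
    last-column : concatMap crossDominoes (range1 (suc L)) ≡ cross (suc L) ++ crossDominoes (suc L)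
    last-column = trans (cong (concatMap crossDominoes) (range1-suc L))
                        (trans (concatMap-++ crossDominoes (range1 L) [ suc L ])
                               (cong (cross (suc L) ++_) (++-identityʳ (crossDominoes (suc L)))))

  All-concatMap-range1 : ∀ {P : Domino → Set} {f : ℕ → List Domino} n →
                         (∀ {j} → 1 ≤ j → j ≤ n → All P (f j)) → All P (concatMap f (range1 n))
  All-concatMap-range1 n f-ok = concat⁺ (map⁺ (All.map (λ (1≤j , j≤n) → f-ok 1≤j j≤n) (range1-bounds n)))

  inner-valid : ∀ n → All (Valid n) (inner n)
  inner-valid n = All-concatMap-range1 n λ 1≤j j≤n →
    map⁺ (applyUpTo⁺₁ (λ k → k) (m ∸ 1) λ {k} k<m∸1 →
      let 1+k<m = ≤∸1⇒< (s≤s z≤n) k<m∸1 in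
      (1≤j , j≤n , <-trans (n<1+n k) 1+k<m) , (1≤j , j≤n , 1+k<m) , 1+n≢n ∘ sym ∘ cong proj₂)

  cross-valid : 2 ≤ m → ∀ n → All (Valid n) (cross n)
  cross-valid 2≤m n = All-concatMap-range1 (n ∸ 1) λ {j} 1≤j j≤n∸1 →
    let j<n = ≤∸1⇒< 1≤j j≤n∸1 in
    ((1≤j , <⇒≤ j<n , <-trans (s≤s z≤n) 2≤m) , (s≤s z≤n , j<n , <-trans (s≤s z≤n) 2≤m) , 1+n≢n ∘ sym ∘ cong proj₁) ∷
    ((1≤j , <⇒≤ j<n , ≤∸1⇒< (m+n≤o⇒m≤o∸n 1 2≤m) ≤-refl) , (s≤s z≤n , j<n , 2≤m) , 1+n≢n ∘ sym ∘ cong proj₁) ∷ []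

-- Weighted counts of tilings

module Counting (q a b : ℕ) where

  open Board q

  -- colorings truncates numSquares q N ∸ 2 * length M, hence the bounds.
  colorings-+ : ∀ {L K} M M₁ M₂ → length M ≡ length M₁ + length M₂ →
                2 * length M₁ ≤ numSquares q L → 2 * length M₂ ≤ numSquares q K →
                colorings q a b (L + K) M ≡ colorings q a b L M₁ * colorings q a b K M₂
  colorings-+ {L} {K} M M₁ M₂ eq bound₁ bound₂
    rewrite eq | *-distribʳ-+ m L K | *-distribˡ-+ 2 (length M₁) (length M₂) | ∸-+-interchange bound₁ bound₂
          | ^-distribˡ-+-* b (length M₁) (length M₂) | ^-distribˡ-+-* a (L * m ∸ 2 * length M₁) (K * m ∸ 2 * length M₂) =
    *-interchange (b ^ length M₁) (b ^ length M₂) _ _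

  dominoSets : ℕ → List (List Domino)
  dominoSets N = sublists (boardDominoes q N)

  tilingWeight : ℕ → (List Domino → Bool) → List Domino → ℕ
  tilingWeight N p M = if pairwiseDisjoint M then (if p M then colorings q a b N M else 0) else 0

  count : ℕ → (List Domino → Bool) → ℕ
  count N p = ∑ (tilingWeight N p) (dominoSets N)

  R-zero : R q a b 0 ≡ 1
  R-zero = refl

  R≡count : ∀ N → R q a b N ≡ count N (λ _ → true)
  R≡count N = ∑-filterᵇ pairwiseDisjoint (colorings q a b N) (dominoSets N)

  R̃≡count : ∀ N → R̃ q a b N ≡ count N (unbreakable N)
  R̃≡count N = trans (∑-filterᵇ (unbreakable N) (colorings q a b N) (tilings q N))
                    (∑-filterᵇ pairwiseDisjoint _ (dominoSets N))

  tilingWeight-reject : ∀ {N p} M → p M ≡ false → tilingWeight N p M ≡ 0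
  tilingWeight-reject M pM≡false rewrite pM≡false with pairwiseDisjoint M
  ... | true  = refl
  ... | false = refl

  tilingWeight-cong : ∀ {N p p′} M → p M ≡ p′ M → tilingWeight N p M ≡ tilingWeight N p′ M
  tilingWeight-cong M pM≡p′M rewrite pM≡p′M = refl

  count-cong : ∀ N {p p′} → (∀ M → p M ≡ p′ M) → count N p ≡ count N p′
  count-cong N {p} {p′} p≗p′ = ∑-cong (λ M → tilingWeight-cong {N} {p} {p′} M (p≗p′ M)) (dominoSets N)

  count-split : ∀ N (p r : List Domino → Bool) → count N p ≡ count N (λ M → p M ∧ r M) + count N (λ M → p M ∧ not (r M))
  count-split N p r = trans (∑-cong split (dominoSets N))
                            (∑-+ (tilingWeight N (λ M → p M ∧ r M)) (tilingWeight N (λ M → p M ∧ not (r M))) (dominoSets N))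
    where
    split : ∀ M → tilingWeight N p M ≡ tilingWeight N (λ M → p M ∧ r M) M + tilingWeight N (λ M → p M ∧ not (r M)) M
    split M with pairwiseDisjoint M | p M | r M
    ... | false | _     | _     = refl
    ... | true  | false | _     = refl
    ... | true  | true  | true  = sym (+-identityʳ (colorings q a b N M))
    ... | true  | true  | false = refl

  firstBreakAt : ℕ → List Domino → Bool
  firstBreakAt L M = unbreakable L M ∧ breakableAt L M

  unbreakable-suc : ∀ L M → unbreakable (suc (suc L)) M ≡ unbreakable (suc L) M ∧ not (breakableAt (suc L) M)
  unbreakable-suc L M = trans (cong (all h) (range1-suc L))
                              (trans (all-++ h (range1 L) [ suc L ]) (cong (all h (range1 L) ∧_) (∧-identityʳ (h (suc L)))))
    where
    h : ℕ → Bool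
    h i = not (breakableAt i M)

  count-unbreakable-suc : ∀ N L → count N (unbreakable (suc L)) ≡ count N (firstBreakAt (suc L)) + count N (unbreakable (suc (suc L)))
  count-unbreakable-suc N L =
    trans (count-split N (unbreakable (suc L)) (breakableAt (suc L)))
          (cong (count N (firstBreakAt (suc L)) +_) (count-cong N (λ M → sym (unbreakable-suc L M))))

  module Glue (L K : ℕ) {A₁ A₂ C₁ C₂ : List Domino}
              (A₁-valid : All (Valid L) A₁) (A₂-valid : All (Valid K) A₂)
              (C₁-valid : All (Valid L) C₁) (C₂-valid : All (Valid K) C₂) where

    -- The blocks of glued come in the order in which count-decompose splits boardDominoes (L + K).
    left right glued : List Domino
    left = A₁ ++ C₁
    right = A₂ ++ C₂
    glued = (A₁ ++ map (shift L) A₂) ++ (C₁ ++ map (shift L) C₂)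

    left-valid : All (Valid L) left
    left-valid = ++⁺ A₁-valid C₁-valid

    right-valid : All (Valid K) right
    right-valid = ++⁺ A₂-valid C₂-valid

    valid⇒LeftOf : ∀ {M} → All (Valid L) M → All (LeftOf L) M
    valid⇒LeftOf = All.map (λ {d} → Valid⇒LeftOf d)

    shifted⇒RightOf : ∀ {M} → All (Valid K) M → All (RightOf L) (map (shift L) M)
    shifted⇒RightOf valid = map⁺ (All.map (λ {d} → Valid⇒RightOf-shift d) valid)

    glued-pairwiseDisjoint : pairwiseDisjoint glued ≡ pairwiseDisjoint left ∧ pairwiseDisjoint right
    glued-pairwiseDisjoint = begin
      pairwiseDisjoint glued
        ≡⟨ pairwiseDisjoint-interleave A₁ (map (shift L) A₂) C₁ (map (shift L) C₂) ⟩
      (pairwiseDisjoint left ∧ pairwiseDisjoint (map (shift L) A₂ ++ map (shift L) C₂))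
        ∧ ((disjoint A₁ (map (shift L) A₂) ∧ disjoint C₁ (map (shift L) C₂))
           ∧ (disjoint A₁ (map (shift L) C₂) ∧ disjoint (map (shift L) A₂) C₁))
        ≡⟨ cong₂ (λ x y → (pairwiseDisjoint left ∧ x) ∧ y) right-shifted separated ⟩
      (pairwiseDisjoint left ∧ pairwiseDisjoint right) ∧ true
        ≡⟨ ∧-identityʳ _ ⟩
      pairwiseDisjoint left ∧ pairwiseDisjoint right
        ∎
      where
      open ≡-Reasoning
      right-shifted : pairwiseDisjoint (map (shift L) A₂ ++ map (shift L) C₂) ≡ pairwiseDisjoint right
      right-shifted = trans (cong pairwiseDisjoint (sym (map-++ (shift L) A₂ C₂))) (pairwiseDisjoint-shift L right)
      disjoint-left-right = disjoint-separated overlaps-LeftOf-RightOf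
      separated = cong₂ _∧_ (cong₂ _∧_ (disjoint-left-right (valid⇒LeftOf A₁-valid) (shifted⇒RightOf A₂-valid))
                                       (disjoint-left-right (valid⇒LeftOf C₁-valid) (shifted⇒RightOf C₂-valid)))
                            (cong₂ _∧_ (disjoint-left-right (valid⇒LeftOf A₁-valid) (shifted⇒RightOf C₂-valid))
                                       (disjoint-separated overlaps-RightOf-LeftOf (shifted⇒RightOf A₂-valid) (valid⇒LeftOf C₁-valid)))

    glued-crosses : ∀ {i} → i ≤ L → any (crosses i) glued ≡ any (crosses i) left
    glued-crosses {i} i≤L =
      trans (any-interleave (crosses i) A₁ (map (shift L) A₂) C₁ (map (shift L) C₂))
            (trans (cong (any (crosses i) left ∨_) (any-false (crosses i) (All.map (λ {d} above → crosses-RightOf d (RightOf-mono d i≤L above))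
                                                                                      (++⁺ (shifted⇒RightOf A₂-valid) (shifted⇒RightOf C₂-valid)))))
                   (∨-identityʳ _))

    glued-breakableAt : breakableAt L glued ≡ true
    glued-breakableAt = cong not (trans (glued-crosses ≤-refl) (any-false (crosses L) (All.map (λ {d} → crosses-LeftOf d) (valid⇒LeftOf left-valid))))

    glued-unbreakable : unbreakable L glued ≡ unbreakable L left
    glued-unbreakable = all-congᴬ (All.map (λ (_ , i≤L∸1) → cong (not ∘ not) (glued-crosses (≤-trans i≤L∸1 (m∸n≤m L 1))))
                                           (range1-bounds (L ∸ 1)))

    glued-length : length glued ≡ length left + length right
    glued-length = trans (length-interleave A₁ (map (shift L) A₂) C₁ (map (shift L) C₂))
                         (cong (length left +_) (trans (cong length (sym (map-++ (shift L) A₂ C₂))) (length-map (shift L) right)))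

    glued-weight : tilingWeight (L + K) (firstBreakAt L) glued
                 ≡ tilingWeight L (unbreakable L) left * tilingWeight K (λ _ → true) right
    glued-weight rewrite glued-pairwiseDisjoint | glued-unbreakable | glued-breakableAt
      with pairwiseDisjoint left in left-ok | pairwiseDisjoint right in right-ok | unbreakable L left
    ... | false | _     | _     = refl
    ... | true  | false | ub    = sym (*-zeroʳ (if ub then colorings q a b L left else 0))
    ... | true  | true  | false = refl
    ... | true  | true  | true  = colorings-+ {L} {K} glued left right glued-length
                                    (tiling-bound left left-valid left-ok) (tiling-bound right right-valid right-ok)

module FirstBreakRecurrence (q a b : ℕ) (2≤m : 2 ≤ q ∸ 2) where

  open Board q
  open Counting q a b

  count-inner-cross : ∀ N p → count N p ≡ ∑ (λ A → ∑ (λ C → tilingWeight N p (A ++ C)) (sublists (cross N))) (sublists (inner N))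
  count-inner-cross N p = trans (cong (∑ (tilingWeight N p) ∘ sublists) (boardDominoes-inner-cross N))
                                (∑-sublists-++ (tilingWeight N p) (inner N) (cross N))

  module _ (L K : ℕ) where

    L⁺ K⁺ : ℕ
    L⁺ = suc L
    K⁺ = suc K

    count-decompose : ∀ p → count (L⁺ + K⁺) p ≡
      ∑ (λ A₁ → ∑ (λ A₂ → ∑ (λ C₁ → ∑ (λ c → ∑ (λ C₂ →
          tilingWeight (L⁺ + K⁺) p ((A₁ ++ map (shift L⁺) A₂) ++ (C₁ ++ (c ++ map (shift L⁺) C₂))))
        (sublists (cross K⁺))) (sublists (crossDominoes L⁺))) (sublists (cross L⁺))) (sublists (inner K⁺))) (sublists (inner L⁺))
    count-decompose p = begin
      count (L⁺ + K⁺) p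
        ≡⟨ cong (∑ w ∘ sublists) (boardDominoes-inner-cross (L⁺ + K⁺)) ⟩
      ∑ w (sublists (inner (L⁺ + K⁺) ++ cross (L⁺ + K⁺)))
        ≡⟨ cong (∑ w ∘ sublists) (cong₂ _++_ (inner-+ L⁺ K⁺) (cross-+ L K)) ⟩
      ∑ w (sublists ((inner L⁺ ++ map (shift L⁺) (inner K⁺)) ++ crossings))
        ≡⟨ ∑-sublists-++ w (inner L⁺ ++ map (shift L⁺) (inner K⁺)) crossings ⟩
      ∑ (λ P → ∑ (λ Q → w (P ++ Q)) (sublists crossings)) (sublists (inner L⁺ ++ map (shift L⁺) (inner K⁺)))
        ≡⟨ ∑-sublists-++-map (λ P → ∑ (λ Q → w (P ++ Q)) (sublists crossings)) (inner L⁺) (shift L⁺) (inner K⁺) ⟩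
      ∑ (λ A₁ → ∑ (λ A₂ → ∑ (λ Q → w ((A₁ ++ map (shift L⁺) A₂) ++ Q)) (sublists crossings)) (sublists (inner K⁺))) (sublists (inner L⁺))
        ≡⟨ ∑-cong (λ A₁ → ∑-cong (λ A₂ → split-crossings (λ Q → w ((A₁ ++ map (shift L⁺) A₂) ++ Q))) (sublists (inner K⁺))) (sublists (inner L⁺)) ⟩
      _ ∎
      where
      open ≡-Reasoning
      w = tilingWeight (L⁺ + K⁺) p
      crossings = cross L⁺ ++ (crossDominoes L⁺ ++ map (shift L⁺) (cross K⁺))
      split-crossings : ∀ h → ∑ h (sublists crossings)
                            ≡ ∑ (λ C₁ → ∑ (λ c → ∑ (λ C₂ → h (C₁ ++ (c ++ map (shift L⁺) C₂))) (sublists (cross K⁺)))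
                                                   (sublists (crossDominoes L⁺))) (sublists (cross L⁺))
      split-crossings h = trans (∑-sublists-++ h (cross L⁺) _)
                                (∑-cong (λ C₁ → ∑-sublists-++-map _ (crossDominoes L⁺) (shift L⁺) (cross K⁺)) (sublists (cross L⁺)))

    firstBreakAt-avoids-crossDominoes : ∀ {A₁ A₂ C₁} → All (Valid L⁺) A₁ → All (Valid K⁺) A₂ → All (Valid L⁺) C₁ →
      ∑ (λ c → ∑ (λ C₂ → tilingWeight (L⁺ + K⁺) (firstBreakAt L⁺) ((A₁ ++ map (shift L⁺) A₂) ++ (C₁ ++ (c ++ map (shift L⁺) C₂))))
                 (sublists (cross K⁺))) (sublists (crossDominoes L⁺))
        ≡ ∑ (λ C₂ → tilingWeight L⁺ (unbreakable L⁺) (A₁ ++ C₁) * tilingWeight K⁺ (λ _ → true) (A₂ ++ C₂)) (sublists (cross K⁺))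
    firstBreakAt-avoids-crossDominoes {A₁} {A₂} {C₁} A₁-valid A₂-valid C₁-valid =
      trans (∑-sublists-[] (crosses-step L⁺ 0 0 ∷ crosses-step L⁺ (m ∸ 1) 1 ∷ [])
                            {λ c → ∑ (λ C₂ → tilingWeight (L⁺ + K⁺) (firstBreakAt L⁺) (glued c C₂)) (sublists (cross K⁺))} vanishes)
            (∑-sublists-congᴬ (cross-valid 2≤m K⁺) (λ C₂ C₂-valid → Glue.glued-weight L⁺ K⁺ A₁-valid A₂-valid C₁-valid C₂-valid))
      where
      glued : List Domino → List Domino → List Domino
      glued c C₂ = (A₁ ++ map (shift L⁺) A₂) ++ (C₁ ++ (c ++ map (shift L⁺) C₂))
      vanishes : ∀ {d} M → crosses L⁺ d ≡ true →
        ∑ (λ C₂ → tilingWeight (L⁺ + K⁺) (firstBreakAt L⁺) (glued (d ∷ M) C₂)) (sublists (cross K⁺)) ≡ 0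
      vanishes {d} M d-crosses =
        trans (∑-cong (λ C₂ → tilingWeight-reject {L⁺ + K⁺} {firstBreakAt L⁺} (glued (d ∷ M) C₂) (broken C₂)) (sublists (cross K⁺)))
              (∑-zero (sublists (cross K⁺)))
        where
        broken : ∀ C₂ → firstBreakAt L⁺ (glued (d ∷ M) C₂) ≡ false
        broken C₂ = trans (cong (λ x → unbreakable L⁺ (glued (d ∷ M) C₂) ∧ not x)
                                (any-++ʳ (crosses L⁺) (A₁ ++ map (shift L⁺) A₂)
                                         (any-++ʳ (crosses L⁺) C₁ (cong (_∨ any (crosses L⁺) (M ++ map (shift L⁺) C₂)) d-crosses))))
                          (∧-zeroʳ (unbreakable L⁺ (glued (d ∷ M) C₂)))

    count-firstBreakAt-+ : count (L⁺ + K⁺) (firstBreakAt L⁺) ≡ count L⁺ (unbreakable L⁺) * count K⁺ (λ _ → true)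
    count-firstBreakAt-+ = begin
      count (L⁺ + K⁺) (firstBreakAt L⁺)
        ≡⟨ count-decompose (firstBreakAt L⁺) ⟩
      _ ≡⟨ ∑-sublists-congᴬ (inner-valid L⁺) (λ A₁ A₁-valid → ∑-sublists-congᴬ (inner-valid K⁺) (λ A₂ A₂-valid →
             ∑-sublists-congᴬ (cross-valid 2≤m L⁺) (λ C₁ C₁-valid → firstBreakAt-avoids-crossDominoes A₁-valid A₂-valid C₁-valid))) ⟩
      ∑ (λ A₁ → ∑ (λ A₂ → ∑ (λ C₁ → ∑ (λ C₂ → leftWeight (A₁ ++ C₁) * rightWeight (A₂ ++ C₂))
          (sublists (cross K⁺))) (sublists (cross L⁺))) (sublists (inner K⁺))) (sublists (inner L⁺))
        ≡⟨ ∑-product² (λ A₁ C₁ → leftWeight (A₁ ++ C₁)) (λ A₂ C₂ → rightWeight (A₂ ++ C₂))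
                      (sublists (inner L⁺)) (sublists (inner K⁺)) (sublists (cross L⁺)) (sublists (cross K⁺)) ⟩
      ∑ (λ A₁ → ∑ (λ C₁ → leftWeight (A₁ ++ C₁)) (sublists (cross L⁺))) (sublists (inner L⁺))
        * ∑ (λ A₂ → ∑ (λ C₂ → rightWeight (A₂ ++ C₂)) (sublists (cross K⁺))) (sublists (inner K⁺))
        ≡⟨ cong₂ _*_ (count-inner-cross L⁺ (unbreakable L⁺)) (count-inner-cross K⁺ (λ _ → true)) ⟨
      count L⁺ (unbreakable L⁺) * count K⁺ (λ _ → true)
        ∎
      where
      open ≡-Reasoning
      leftWeight rightWeight : List Domino → ℕ
      leftWeight = tilingWeight L⁺ (unbreakable L⁺)
      rightWeight = tilingWeight K⁺ (λ _ → true)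

  count-firstBreakAt : ∀ {N} L → suc L < N → count N (firstBreakAt (suc L)) ≡ R̃ q a b (suc L) * R q a b (N ∸ suc L)
  count-firstBreakAt L 1+L<N with K , refl ← m≤n⇒∃[o]m+o≡n 1+L<N = begin
    count (suc (suc L) + K) (firstBreakAt (suc L))
      ≡⟨ cong (λ N → count N (firstBreakAt (suc L))) (+-suc (suc L) K) ⟨
    count (suc L + suc K) (firstBreakAt (suc L))
      ≡⟨ count-firstBreakAt-+ L K ⟩
    count (suc L) (unbreakable (suc L)) * count (suc K) (λ _ → true)
      ≡⟨ cong₂ _*_ (R̃≡count (suc L)) (R≡count (suc K)) ⟨
    R̃ q a b (suc L) * R q a b (suc K)
      ≡⟨ cong (λ N → R̃ q a b (suc L) * R q a b N) (trans (sym (m+n∸m≡n (suc L) (suc K))) (cong (_∸ suc L) (+-suc (suc L) K))) ⟩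
    R̃ q a b (suc L) * R q a b (suc (suc L) + K ∸ suc L)
      ∎
    where open ≡-Reasoning

  R-telescope : ∀ N L → suc L ≤ N →
                R q a b N ≡ Σ₁ L (λ l → R̃ q a b l * R q a b (N ∸ l)) + count N (unbreakable (suc L))
  R-telescope N zero    _      = R≡count N
  R-telescope N (suc L) 2+L≤N = begin
    R q a b N
      ≡⟨ R-telescope N L (<⇒≤ 2+L≤N) ⟩
    Σ₁ L f + count N (unbreakable (suc L))
      ≡⟨ cong (Σ₁ L f +_) (count-unbreakable-suc N L) ⟩
    Σ₁ L f + (count N (firstBreakAt (suc L)) + rest)
      ≡⟨ cong (λ x → Σ₁ L f + (x + rest)) (count-firstBreakAt L 2+L≤N) ⟩
    Σ₁ L f + (f (suc L) + rest)
      ≡⟨ +-assoc (Σ₁ L f) (f (suc L)) rest ⟨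
    Σ₁ L f + f (suc L) + rest
      ≡⟨ cong (_+ rest) (Σ₁-suc L f) ⟨
    Σ₁ (suc L) f + rest
      ∎
    where
    open ≡-Reasoning
    f : ℕ → ℕ
    f l = R̃ q a b l * R q a b (N ∸ l)
    rest : ℕ
    rest = count N (unbreakable (suc (suc L)))

  R-suc : ∀ N → R q a b (suc N) ≡ (R̃ q a b ⋆ R q a b) (suc N)
  R-suc N = begin
    R q a b (suc N)
      ≡⟨ R-telescope (suc N) N ≤-refl ⟩
    Σ₁ N f + count (suc N) (unbreakable (suc N))
      ≡⟨ cong (Σ₁ N f +_) (trans (sym (R̃≡count (suc N))) (sym (*-identityʳ (R̃ q a b (suc N))))) ⟩
    Σ₁ N f + R̃ q a b (suc N) * R q a b 0
      ≡⟨ ⋆-suc (R̃ q a b) (R q a b) N ⟨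
    (R̃ q a b ⋆ R q a b) (suc N)
      ∎
    where
    open ≡-Reasoning
    f : ℕ → ℕ
    f l = R̃ q a b l * R q a b (suc N ∸ l)

2*n≡[n∸k]+[n+k] : ∀ {n k} → k ≤ n → 2 * n ≡ (n ∸ k) + (n + k)
2*n≡[n∸k]+[n+k] {n} {k} k≤n = begin
  2 * n              ≡⟨ cong (n +_) (+-identityʳ n) ⟩
  n + n              ≡⟨ cong (_+ n) (m∸n+n≡m k≤n) ⟨
  (n ∸ k) + k + n    ≡⟨ +-assoc (n ∸ k) k n ⟩
  (n ∸ k) + (k + n)  ≡⟨ cong ((n ∸ k) +_) (+-comm k n) ⟩
  (n ∸ k) + (n + k)  ∎
  where open ≡-Reasoning

mainTheorem10 : (q a b : ℕ) → 4 ≤ q → 1 ≤ a → 1 ≤ b → (n k : ℕ) → k < n →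
  R q a b (2 * n) ≡ R q a b (n ∸ k) * R q a b (n + k)
    + Σ₁ (n ∸ k) (λ i → Σ₁ (n + k) (λ j →
        R q a b (n ∸ k ∸ i) * R q a b (n + k ∸ j) * R̃ q a b (i + j)))
mainTheorem10 q a b 4≤q _ _ n k k<n = begin
  R q a b (2 * n)              ≡⟨ cong (R q a b) (2*n≡[n∸k]+[n+k] (<⇒≤ k<n)) ⟩
  R q a b ((n ∸ k) + (n + k))  ≡⟨ r-+ (n ∸ k) (n + k) ⟩
  _                            ∎
  where
  open ≡-Reasoning
  open ConvolutionSplit (R q a b) (R̃ q a b) (Counting.R-zero q a b) (FirstBreakRecurrence.R-suc q a b (∸-monoˡ-≤ 2 4≤q))
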